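{- Let $(G,\circ)$ be a finite group, let $N$ be a $G$-stable regular subgroup of $\mathrm{Perm}(G)$, let $(G,\star,\circ)$ be the corresponding skew brace, and let $g\in G$. The following are equivalent: (i) $N$ is normalized by $\rho(g)$; (ii) the inner automorphism $\varphi_g$ of $(G,\circ)$ lies in $\mathrm{Aut}(G,\star,\circ)$; (iii) $(y\star z)\circ g=(y\circ g)\star g^{ -1}\star(z\circ g)$ for all $y,z\in G$, where $g^{ -1}$ denotes the inverse of $g$ with respect to $\star$.
   Context: $\mathrm{Perm}(G)$ is the group of permutations of the set $G$; $\lambda(g)[h]=g\circ h$ and $\rho(g)[h]=h\circ \bar g$, where $\bar g$ is the inverse of $g$ in $(G,\circ)$. A subgroup $N\le\mathrm{Perm}(G)$ is regular if it acts simply transitively on $G$ and $G$-stable if normalized by $\lambda(G)$. A (left) skew brace is a triple $(B,\star,\circ)$ of a set with two group operations such that $x\circ(y\star z)=(x\circ y)\star x^{ -1}\star(x\circ z)$ for all $x,y,z$ ($x^{ -1}$ the $\star$-inverse). The skew brace corresponding to $N$: since $\eta\mapsto\eta[e_G]$ is a bijection $N\to G$, define $\eta[e_G]\star\mu[e_G]=\eta\mu[e_G]$ for $\eta,\mu\in N$; then $(G,\star,\circ)$ is a skew brace. $\varphi_g(h)=g\circ h\circ\bar g$. $\mathrm{Aut}(G,\star,\circ)$ is the group of automorphisms of $(G,\circ)$ that are also automorphisms of $(G,\star)$. -}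

module Defs where

open import Data.Nat using (ℕ)
open import Data.Fin using (Fin)
open import Data.Product using (Σ; _×_; _,_; proj₁; proj₂)
open import Function.Bundles using (_↔_; mk↔ₛ′; Inverse)
open import Function.Definitions using (Bijective)
open import Function.Construct.Composition using (_↔-∘_)
open import Function.Construct.Identity using (↔-id)
open import Function.Construct.Symmetry using (↔-sym)
open import Algebra.Core using (Op₁; Op₂)
open import Algebra.Structures using (IsGroup)
open import Relation.Binary.PropositionalEquality using (_≡_; refl; sym; trans; cong)

record FiniteGroup : Set₁ where
  infixl 7 _∘_
  field
    Carrier : Set
    _∘_     : Op₂ Carrier
    e       : Carrier
    inv     : Op₁ Carrier
    isGroup : IsGroup _≡_ _∘_ e inv
    size    : ℕ
    finite  : Carrier ↔ Fin size

module OnGroup (G : FiniteGroup) where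
  open FiniteGroup G public
  open IsGroup isGroup using (assoc; identityˡ; identityʳ; inverseˡ; inverseʳ)

  Perm : Set
  Perm = Carrier ↔ Carrier

  _⟦_⟧ : Perm → Carrier → Carrier
  η ⟦ x ⟧ = Inverse.to η x

  _≈ₚ_ : Perm → Perm → Set
  η ≈ₚ μ = ∀ x → η ⟦ x ⟧ ≡ μ ⟦ x ⟧

  -- group operations of Perm(G): (η · μ)[x] = η[μ[x]]
  infixl 7 _·_
  _·_ : Perm → Perm → Perm
  η · μ = η ↔-∘ μ

  idP : Perm
  idP = ↔-id Carrier

  invP : Perm → Perm
  invP = ↔-sym

  private
    cancel₁ : ∀ g h → g ∘ (inv g ∘ h) ≡ h
    cancel₁ g h = trans (sym (assoc g (inv g) h))
                        (trans (cong (_∘ h) (inverseʳ g)) (identityˡ h))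
    cancel₂ : ∀ g h → inv g ∘ (g ∘ h) ≡ h
    cancel₂ g h = trans (sym (assoc (inv g) g h))
                        (trans (cong (_∘ h) (inverseˡ g)) (identityˡ h))
    cancel₃ : ∀ g h → (h ∘ g) ∘ inv g ≡ h
    cancel₃ g h = trans (assoc h g (inv g))
                        (trans (cong (h ∘_) (inverseʳ g)) (identityʳ h))
    cancel₄ : ∀ g h → (h ∘ inv g) ∘ g ≡ h
    cancel₄ g h = trans (assoc h (inv g) g)
                        (trans (cong (h ∘_) (inverseˡ g)) (identityʳ h))

  lam : Carrier → Perm
  lam g = mk↔ₛ′ (λ h → g ∘ h) (λ h → inv g ∘ h) (cancel₁ g) (cancel₂ g)

  rho : Carrier → Perm
  rho g = mk↔ₛ′ (λ h → h ∘ inv g) (λ h → h ∘ g) (cancel₃ g) (cancel₄ g)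

  φ : Carrier → Carrier → Carrier
  φ g h = g ∘ h ∘ inv g

  record IsSubgroup (N : Perm → Set) : Set where
    field
      respects : ∀ {η μ} → η ≈ₚ μ → N η → N μ
      hasId    : N idP
      closed·  : ∀ {η μ} → N η → N μ → N (η · μ)
      closedInv : ∀ {η} → N η → N (invP η)

  Regular : (Perm → Set) → Set
  Regular N =
    (∀ x y → Σ Perm λ η → N η × (η ⟦ x ⟧ ≡ y)) ×
    (∀ x η μ → N η → N μ → η ⟦ x ⟧ ≡ μ ⟦ x ⟧ → η ≈ₚ μ)

  NormalizedBy : (Perm → Set) → Perm → Set
  NormalizedBy N π = ∀ η → N η → N (π · η · invP π) × N (invP π · η · π)

  GStable : (Perm → Set) → Set
  GStable N = ∀ g → NormalizedBy N (lam g)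

  module Brace (N : Perm → Set) (reg : Regular N) where
    elt : Carrier → Perm
    elt x = proj₁ (proj₁ reg e x)

    -- η[e] ⋆ μ[e] = (η μ)[e]; with η = η_x, μ = η_y this is x ⋆ y = η_x[y]
    infixl 6 _⋆_
    _⋆_ : Carrier → Carrier → Carrier
    x ⋆ y = (elt x · elt y) ⟦ e ⟧

    ⋆inv : Carrier → Carrier
    ⋆inv x = invP (elt x) ⟦ e ⟧

    IsBraceAut : (Carrier → Carrier) → Set
    IsBraceAut f = Bijective _≡_ _≡_ f
                 × (∀ x y → f (x ∘ y) ≡ f x ∘ f y)
                 × (∀ x y → f (x ⋆ y) ≡ f x ⋆ f y)

{-# OPTIONS --safe #-}
-- A regular N is the left regular representation of (G, ⋆): η ∈ N iff η[x] = η[e] ⋆ x.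
-- Hence a permutation π satisfies π N π⁻¹ ⊆ N iff π is a morphism of the heap
-- [x, y, z] = x ⋆ y⁻¹ ⋆ z, and π normalizes N iff π is a heap morphism, heap morphisms
-- being closed under composition and inversion. All three conditions then say that
-- ρ(g) is a heap morphism: (i) directly; (ii) because φ_g = ρ(g) λ(g), where λ(g) is a
-- heap morphism by G-stability, and a heap morphism fixing e is a ⋆-homomorphism;
-- (iii) because it says that ρ(g)⁻¹ is affine.
module Submission where

open import Defs
open import Algebra.Bundles using (Group)
open import Algebra.Structures using (IsGroup)
import Algebra.Properties.Group as GroupProperties
open import Data.Product using (_×_; _,_; proj₁; proj₂)
open import Function.Bundles using (_⇔_; mk⇔; Inverse; Equivalence; Bijection)
open import Function.Definitions using (Bijective)
open import Function.Properties.Equivalence using () renaming (trans to ⇔-trans; sym to ⇔-sym)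
open import Function.Properties.Inverse using (↔⇒⤖)
open import Relation.Binary.PropositionalEquality
  using (_≡_; _≗_; refl; sym; trans; cong; cong₂; isEquivalence; module ≡-Reasoning)

module InnerAutomorphisms (G : FiniteGroup) where
  open OnGroup G
  open ≡-Reasoning

  ∘-group : Group _ _
  ∘-group = record { isGroup = isGroup }

  open Group ∘-group using (assoc; identityʳ; inverseʳ)
  open GroupProperties ∘-group using (\\-leftDividesʳ)

  φ-bijective : ∀ g → Bijective _≡_ _≡_ (φ g)
  φ-bijective g = Bijection.bijective (↔⇒⤖ (rho g · lam g))

  φ-e : ∀ g → φ g e ≡ e
  φ-e g = trans (cong (_∘ inv g) (identityʳ g)) (inverseʳ g)

  φ-homo : ∀ g x y → φ g (x ∘ y) ≡ φ g x ∘ φ g y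
  φ-homo g x y = begin
    g ∘ (x ∘ y) ∘ inv g                   ≡⟨ cong (_∘ inv g) (assoc g x y) ⟨
    g ∘ x ∘ y ∘ inv g                     ≡⟨ assoc (g ∘ x) y (inv g) ⟩
    (g ∘ x) ∘ (y ∘ inv g)                 ≡⟨ cong (λ w → (g ∘ x) ∘ (w ∘ inv g)) (\\-leftDividesʳ g y) ⟨
    (g ∘ x) ∘ (inv g ∘ (g ∘ y) ∘ inv g)   ≡⟨ cong ((g ∘ x) ∘_) (assoc (inv g) (g ∘ y) (inv g)) ⟩
    (g ∘ x) ∘ (inv g ∘ (g ∘ y ∘ inv g))   ≡⟨ assoc (g ∘ x) (inv g) (g ∘ y ∘ inv g) ⟨
    g ∘ x ∘ inv g ∘ (g ∘ y ∘ inv g)       ∎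

module RegularSubgroup (G : FiniteGroup) {N : OnGroup.Perm G → Set}
                       (sub : OnGroup.IsSubgroup G N) (reg : OnGroup.Regular G N) where
  open OnGroup G
  open IsSubgroup sub
  open Brace N reg
  open InnerAutomorphisms G
  open Group ∘-group using (identityˡ)
  open GroupProperties ∘-group using (\\-leftDividesˡ; //-rightDividesˡ; //-rightDividesʳ)
  open ≡-Reasoning

  elt-∈N : ∀ x → N (elt x)
  elt-∈N x = proj₁ (proj₂ (proj₁ reg e x))

  elt-e : ∀ x → elt x ⟦ e ⟧ ≡ x
  elt-e x = proj₂ (proj₂ (proj₁ reg e x))

  ⋆-elt : ∀ x y → x ⋆ y ≡ elt x ⟦ y ⟧
  ⋆-elt x y = cong (elt x ⟦_⟧) (elt-e y)

  ∈N⇒translation : ∀ {η} → N η → ∀ x → η ⟦ x ⟧ ≡ η ⟦ e ⟧ ⋆ x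
  ∈N⇒translation {η} η∈N x =
    trans (proj₂ reg e η (elt a) η∈N (elt-∈N a) (sym (elt-e a)) x) (sym (⋆-elt a x))
    where a = η ⟦ e ⟧

  translation⇒∈N : ∀ {π} c → (∀ x → π ⟦ x ⟧ ≡ c ⋆ x) → N π
  translation⇒∈N c π-translation =
    respects (λ x → trans (sym (⋆-elt c x)) (sym (π-translation x))) (elt-∈N c)

  ⋆-assoc : ∀ x y z → (x ⋆ y) ⋆ z ≡ x ⋆ (y ⋆ z)
  ⋆-assoc x y z = begin
    (x ⋆ y) ⋆ z               ≡⟨ ∈N⇒translation (closed· (elt-∈N x) (elt-∈N y)) z ⟨
    elt x ⟦ elt y ⟦ z ⟧ ⟧     ≡⟨ cong (elt x ⟦_⟧) (⋆-elt y z) ⟨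
    elt x ⟦ y ⋆ z ⟧           ≡⟨ ⋆-elt x (y ⋆ z) ⟨
    x ⋆ (y ⋆ z)               ∎

  ⋆-inverseˡ : ∀ x → ⋆inv x ⋆ x ≡ e
  ⋆-inverseˡ x = begin
    ⋆inv x ⋆ x                        ≡⟨ ∈N⇒translation (closedInv (elt-∈N x)) x ⟨
    Inverse.from (elt x) x            ≡⟨ cong (Inverse.from (elt x)) (elt-e x) ⟨
    Inverse.from (elt x) (elt x ⟦ e ⟧) ≡⟨ Inverse.strictlyInverseʳ (elt x) e ⟩
    e                                 ∎

  ⋆-isGroup : IsGroup _≡_ _⋆_ e ⋆inv
  ⋆-isGroup = record
    { isMonoid = record
      { isSemigroup = record
        { isMagma = record { isEquivalence = isEquivalence ; ∙-cong = cong₂ _⋆_ }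
        ; assoc   = ⋆-assoc
        }
      ; identity = (λ x → sym (∈N⇒translation hasId x))
                 , (λ x → trans (⋆-elt x e) (elt-e x))
      }
    ; inverse = ⋆-inverseˡ
              , (λ x → trans (⋆-elt x (⋆inv x)) (Inverse.strictlyInverseˡ (elt x) e))
    ; ⁻¹-cong = cong ⋆inv
    }

  ⋆-group : Group _ _
  ⋆-group = record { isGroup = ⋆-isGroup }

  open Group ⋆-group using () renaming (identityʳ to ⋆-identityʳ)
  open GroupProperties ⋆-group
    using (ε⁻¹≈ε; x≈z//y; y≈x\\z)
    renaming (\\-leftDividesˡ to ⋆-\\-leftDividesˡ; //-rightDividesˡ to ⋆-//-rightDividesˡ)

  heap : Carrier → Carrier → Carrier → Carrier
  heap x y z = x ⋆ ⋆inv y ⋆ z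

  heap-cong : ∀ {x x′ y y′ z z′} → x ≡ x′ → y ≡ y′ → z ≡ z′ → heap x y z ≡ heap x′ y′ z′
  heap-cong refl refl refl = refl

  heap-e : ∀ x z → heap x e z ≡ x ⋆ z
  heap-e x z = cong (_⋆ z) (trans (cong (x ⋆_) ε⁻¹≈ε) (⋆-identityʳ x))

  IsHeapMorphism : (Carrier → Carrier) → Set
  IsHeapMorphism f = ∀ x y z → f (heap x y z) ≡ heap (f x) (f y) (f z)

  heapMorphism-∘ : ∀ {f k} → IsHeapMorphism f → IsHeapMorphism k → IsHeapMorphism (λ x → f (k x))
  heapMorphism-∘ {f} f-heap k-heap x y z = trans (cong f (k-heap x y z)) (f-heap _ _ _)

  heapMorphism-resp : ∀ {f k} → f ≗ k → IsHeapMorphism f → IsHeapMorphism k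
  heapMorphism-resp {f} {k} f≗k f-heap x y z = begin
    k (heap x y z)             ≡⟨ f≗k (heap x y z) ⟨
    f (heap x y z)             ≡⟨ f-heap x y z ⟩
    heap (f x) (f y) (f z)     ≡⟨ heap-cong (f≗k x) (f≗k y) (f≗k z) ⟩
    heap (k x) (k y) (k z)     ∎

  heapMorphism-inverse : ∀ {f k} → (∀ x → f (k x) ≡ x) → (∀ x → k (f x) ≡ x) →
                         IsHeapMorphism f → IsHeapMorphism k
  heapMorphism-inverse {f} {k} fk kf f-heap x y z = begin
    k (heap x y z)                         ≡⟨ cong k (heap-cong (fk x) (fk y) (fk z)) ⟨
    k (heap (f (k x)) (f (k y)) (f (k z))) ≡⟨ cong k (f-heap (k x) (k y) (k z)) ⟨
    k (f (heap (k x) (k y) (k z)))         ≡⟨ kf _ ⟩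
    heap (k x) (k y) (k z)                 ∎

  IsAffineOver : Carrier → (Carrier → Carrier) → Set
  IsAffineOver c f = ∀ y z → f (y ⋆ z) ≡ heap (f y) c (f z)

  affineOver⇒heapMorphism : ∀ {c f} → IsAffineOver c f → IsHeapMorphism f
  affineOver⇒heapMorphism {c} {f} f-affine x y z = begin
    f (x ⋆ ⋆inv y ⋆ z)                     ≡⟨ cong f (⋆-assoc x (⋆inv y) z) ⟩
    f (x ⋆ (⋆inv y ⋆ z))                   ≡⟨ f-affine x (⋆inv y ⋆ z) ⟩
    f x ⋆ ⋆inv c ⋆ f (⋆inv y ⋆ z)          ≡⟨ ⋆-assoc (f x) (⋆inv c) _ ⟩
    f x ⋆ (⋆inv c ⋆ f (⋆inv y ⋆ z))        ≡⟨ cong (f x ⋆_) quotient ⟩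
    f x ⋆ (⋆inv (f y) ⋆ f z)               ≡⟨ ⋆-assoc (f x) (⋆inv (f y)) (f z) ⟨
    f x ⋆ ⋆inv (f y) ⋆ f z                 ∎
    where
    quotient : ⋆inv c ⋆ f (⋆inv y ⋆ z) ≡ ⋆inv (f y) ⋆ f z
    quotient = y≈x\\z (f y) _ (f z) (begin
      f y ⋆ (⋆inv c ⋆ f (⋆inv y ⋆ z))     ≡⟨ ⋆-assoc (f y) (⋆inv c) _ ⟨
      f y ⋆ ⋆inv c ⋆ f (⋆inv y ⋆ z)       ≡⟨ f-affine y (⋆inv y ⋆ z) ⟨
      f (y ⋆ (⋆inv y ⋆ z))                ≡⟨ cong f (⋆-\\-leftDividesˡ y z) ⟩
      f z                                 ∎)

  heapMorphism⇒affineOver : ∀ {c f} → f e ≡ c → IsHeapMorphism f → IsAffineOver c f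
  heapMorphism⇒affineOver {c} {f} fe≡c f-heap y z = begin
    f (y ⋆ z)                  ≡⟨ cong f (heap-e y z) ⟨
    f (heap y e z)             ≡⟨ f-heap y e z ⟩
    heap (f y) (f e) (f z)     ≡⟨ cong (λ d → heap (f y) d (f z)) fe≡c ⟩
    heap (f y) c (f z)         ∎

  affineOver⇔heapMorphism : ∀ {c f} → f e ≡ c → IsAffineOver c f ⇔ IsHeapMorphism f
  affineOver⇔heapMorphism fe≡c = mk⇔ affineOver⇒heapMorphism (heapMorphism⇒affineOver fe≡c)

  ⋆-homo⇔heapMorphism : ∀ {f} → f e ≡ e → (∀ x y → f (x ⋆ y) ≡ f x ⋆ f y) ⇔ IsHeapMorphism f
  ⋆-homo⇔heapMorphism {f} fe≡e = ⇔-trans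
    (mk⇔ (λ homo y z → trans (homo y z) (sym (heap-e (f y) (f z))))
         (λ affine y z → trans (affine y z) (heap-e (f y) (f z))))
    (affineOver⇔heapMorphism fe≡e)

  conjugate-∈N⇒heapMorphism : ∀ π → (∀ η → N η → N (π · η · invP π)) → IsHeapMorphism (π ⟦_⟧)
  conjugate-∈N⇒heapMorphism π conjugate-∈N x y z = begin
    π ⟦ a ⋆ z ⟧                       ≡⟨ μ-on-π z ⟨
    μ ⟦ π ⟦ z ⟧ ⟧                     ≡⟨ μ-translation (π ⟦ z ⟧) ⟩
    μ ⟦ e ⟧ ⋆ π ⟦ z ⟧                 ≡⟨ cong (_⋆ π ⟦ z ⟧) μ-e ⟩
    π ⟦ x ⟧ ⋆ ⋆inv (π ⟦ y ⟧) ⋆ π ⟦ z ⟧ ∎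
    where
    a = x ⋆ ⋆inv y
    μ = π · elt a · invP π
    μ-translation : ∀ w → μ ⟦ w ⟧ ≡ μ ⟦ e ⟧ ⋆ w
    μ-translation = ∈N⇒translation (conjugate-∈N (elt a) (elt-∈N a))
    μ-on-π : ∀ w → μ ⟦ π ⟦ w ⟧ ⟧ ≡ π ⟦ a ⋆ w ⟧
    μ-on-π w = cong (π ⟦_⟧) (trans (cong (elt a ⟦_⟧) (Inverse.strictlyInverseʳ π w))
                                   (sym (⋆-elt a w)))
    μ-e : μ ⟦ e ⟧ ≡ π ⟦ x ⟧ ⋆ ⋆inv (π ⟦ y ⟧)
    μ-e = x≈z//y _ _ _ (begin
      μ ⟦ e ⟧ ⋆ π ⟦ y ⟧   ≡⟨ μ-translation (π ⟦ y ⟧) ⟨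
      μ ⟦ π ⟦ y ⟧ ⟧       ≡⟨ μ-on-π y ⟩
      π ⟦ a ⋆ y ⟧         ≡⟨ cong (π ⟦_⟧) (⋆-//-rightDividesˡ y x) ⟩
      π ⟦ x ⟧             ∎)

  heapMorphism⇒conjugate-∈N : ∀ π → IsHeapMorphism (π ⟦_⟧) → ∀ η → N η → N (π · η · invP π)
  heapMorphism⇒conjugate-∈N π π-heap η η∈N = translation⇒∈N (π ⟦ a ⟧ ⋆ ⋆inv (π ⟦ e ⟧)) λ x → begin
    π ⟦ η ⟦ π⁻¹ x ⟧ ⟧                            ≡⟨ cong (π ⟦_⟧) (∈N⇒translation η∈N (π⁻¹ x)) ⟩
    π ⟦ a ⋆ π⁻¹ x ⟧                              ≡⟨ heapMorphism⇒affineOver refl π-heap a (π⁻¹ x) ⟩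
    π ⟦ a ⟧ ⋆ ⋆inv (π ⟦ e ⟧) ⋆ π ⟦ π⁻¹ x ⟧       ≡⟨ cong (π ⟦ a ⟧ ⋆ ⋆inv (π ⟦ e ⟧) ⋆_)
                                                      (Inverse.strictlyInverseˡ π x) ⟩
    π ⟦ a ⟧ ⋆ ⋆inv (π ⟦ e ⟧) ⋆ x                 ∎
    where
    a = η ⟦ e ⟧
    π⁻¹ = Inverse.from π

  normalizedBy⇔heapMorphism : ∀ π → NormalizedBy N π ⇔ IsHeapMorphism (π ⟦_⟧)
  normalizedBy⇔heapMorphism π = mk⇔
    (λ normalized → conjugate-∈N⇒heapMorphism π (λ η η∈N → proj₁ (normalized η η∈N)))
    (λ π-heap η η∈N → heapMorphism⇒conjugate-∈N π π-heap η η∈N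
                    , heapMorphism⇒conjugate-∈N (invP π) (π⁻¹-heap π-heap) η η∈N)
    where
    π⁻¹-heap : IsHeapMorphism (π ⟦_⟧) → IsHeapMorphism (Inverse.from π)
    π⁻¹-heap = heapMorphism-inverse (Inverse.strictlyInverseˡ π) (Inverse.strictlyInverseʳ π)

  braceAut⇔⋆-homo : ∀ {f} → Bijective _≡_ _≡_ f → (∀ x y → f (x ∘ y) ≡ f x ∘ f y) →
                    IsBraceAut f ⇔ (∀ x y → f (x ⋆ y) ≡ f x ⋆ f y)
  braceAut⇔⋆-homo bijective ∘-homo = mk⇔ (λ aut → proj₂ (proj₂ aut)) (λ ⋆-homo → bijective , ∘-homo , ⋆-homo)

  ρ⁻¹-affineOver⇔ρ-heapMorphism : ∀ g → IsAffineOver g (_∘ g) ⇔ IsHeapMorphism (rho g ⟦_⟧)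
  ρ⁻¹-affineOver⇔ρ-heapMorphism g = ⇔-trans (affineOver⇔heapMorphism (identityˡ g))
    (mk⇔ (heapMorphism-inverse (//-rightDividesˡ g) (//-rightDividesʳ g))
         (heapMorphism-inverse (//-rightDividesʳ g) (//-rightDividesˡ g)))

  module _ (stable : GStable N) where

    λ-heapMorphism : ∀ h → IsHeapMorphism (lam h ⟦_⟧)
    λ-heapMorphism h = Equivalence.to (normalizedBy⇔heapMorphism (lam h)) (stable h)

    φ-heapMorphism⇔ρ-heapMorphism : ∀ g → IsHeapMorphism (φ g) ⇔ IsHeapMorphism (rho g ⟦_⟧)
    φ-heapMorphism⇔ρ-heapMorphism g = mk⇔
      (λ φ-heap → heapMorphism-resp (λ x → cong (_∘ inv g) (\\-leftDividesˡ g x))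
                                    (heapMorphism-∘ φ-heap (λ-heapMorphism (inv g))))
      (λ ρ-heap → heapMorphism-∘ ρ-heap (λ-heapMorphism g))

theorem4p2 : (G : FiniteGroup) →
    let open OnGroup G in
    (N : Perm → Set) → IsSubgroup N → (reg : Regular N) → GStable N →
    (g : Carrier) →
    let open Brace N reg in
    (NormalizedBy N (rho g) ⇔ IsBraceAut (φ g)) ×
    (IsBraceAut (φ g) ⇔ (∀ y z → (y ⋆ z) ∘ g ≡ (y ∘ g) ⋆ ⋆inv g ⋆ (z ∘ g)))
theorem4p2 G N sub reg stable g =
    ⇔-trans (normalizedBy⇔heapMorphism (rho g)) (⇔-sym braceAut-φ⇔ρ-heapMorphism)
  , ⇔-trans braceAut-φ⇔ρ-heapMorphism (⇔-sym (ρ⁻¹-affineOver⇔ρ-heapMorphism g))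
  where
  open OnGroup G
  open Brace N reg
  open InnerAutomorphisms G
  open RegularSubgroup G sub reg

  braceAut-φ⇔ρ-heapMorphism : IsBraceAut (φ g) ⇔ IsHeapMorphism (rho g ⟦_⟧)
  braceAut-φ⇔ρ-heapMorphism =
    ⇔-trans (braceAut⇔⋆-homo (φ-bijective g) (φ-homo g))
    (⇔-trans (⋆-homo⇔heapMorphism (φ-e g))
             (φ-heapMorphism⇔ρ-heapMorphism stable g))
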